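{- Suppose $S \subseteq [n]$ does not contain any punctured $4$-AP. Then $\operatorname{aw}([n], k) > |S|+1$ for all integers $n\ge k \geq 4$.
   Context: $[n]=\{1,\dots,n\}$. A $k$-AP is a set of $k$ distinct integers $a,a+d,\dots,a+(k-1)d$ with $d\ge 1$. A punctured $4$-AP is a $3$-element subset of a $4$-AP. An $r$-coloring of $[n]$ is a map $[n]\to\{1,\dots,r\}$, exact if surjective; a $k$-AP is rainbow if its elements receive $k$ distinct colors. $\operatorname{aw}([n],k)$ is the smallest $r$ such that every exact $r$-coloring of $[n]$ contains a rainbow $k$-AP. -}

module Defs where

open import Data.Nat using (ℕ; _+_; _*_; _∸_; _≤_; _<_)
open import Data.Fin using (Fin; toℕ)
open import Data.Product using (Σ; ∃; _×_)
open import Data.List using (List; length)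
open import Data.List.Membership.Propositional using (_∈_)
open import Data.List.Relation.Unary.Unique.Propositional using (Unique)
open import Relation.Binary.PropositionalEquality using (_≡_; _≢_)
open import Relation.Nullary using (¬_)

InRange : ℕ → ℕ → Set
InRange n x = 1 ≤ x × x ≤ n

-- An r-coloring of [n]: a map c with c x ∈ {1,…,r} for every x ∈ [n]
-- (values of c outside [n] are irrelevant).
IsColoring : ℕ → ℕ → (ℕ → ℕ) → Set
IsColoring n r c = ∀ x → InRange n x → InRange r (c x)

IsExactColoring : ℕ → ℕ → (ℕ → ℕ) → Set
IsExactColoring n r c =
  IsColoring n r c × (∀ j → InRange r j → ∃ λ x → InRange n x × c x ≡ j)

IsAPIn : ℕ → ℕ → ℕ → ℕ → Set
IsAPIn n k a d = 1 ≤ d × 1 ≤ a × a + (k ∸ 1) * d ≤ n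

IsRainbow : (ℕ → ℕ) → ℕ → ℕ → ℕ → Set
IsRainbow c k a d = ∀ i j → i < k → j < k → i ≢ j → c (a + i * d) ≢ c (a + j * d)

HasRainbowAP : ℕ → ℕ → (ℕ → ℕ) → Set
HasRainbowAP n k c = ∃ λ a → ∃ λ d → IsAPIn n k a d × IsRainbow c k a d

RainbowForced : ℕ → ℕ → ℕ → Set
RainbowForced n k r = ∀ (c : ℕ → ℕ) → IsExactColoring n r c → HasRainbowAP n k c

-- aw([n],k) > m : no r with 1 ≤ r ≤ m forces a rainbow k-AP
-- (aw is the least such r ≥ 1).
AwGreater : ℕ → ℕ → ℕ → Set
AwGreater n k m = ∀ r → 1 ≤ r → r ≤ m → ¬ RainbowForced n k r

-- S ⊆ [n], S given as a duplicate-free list (|S| = length S)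
IsSubsetOfRange : ℕ → List ℕ → Set
IsSubsetOfRange n S = Unique S × (∀ x → x ∈ S → InRange n x)

ContainsPuncturedFourAP : List ℕ → Set
ContainsPuncturedFourAP S =
  ∃ λ a → ∃ λ d → 1 ≤ d × Σ (Fin 4) λ i → ∀ (j : Fin 4) → j ≢ i → a + toℕ j * d ∈ S

module Submission where

-- Let 1 ≤ r ≤ |S| + 1 and let T consist of r - 1 elements of S.  Colour
-- the elements of T with the distinct colours 2, …, r (by position in the
-- list T) and every other integer with colour 1.  This is an exact
-- r-colouring of [n]: colour 1 is used because S, having no punctured
-- 4-AP, misses one of 1, 2, 3 (these form the 4-AP 1,2,3,4 punctured at 4).
-- A rainbow k-AP with k ≥ 4 would have four rainbow initial terms; at most
-- one of them has colour 1, so the other three lie in T ⊆ S and form a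
-- punctured 4-AP in S — a contradiction.

open import Defs
open import Data.Nat using (ℕ; zero; suc; _+_; _*_; _≤_; s≤s; z≤n)
open import Data.Nat.Properties
  using (_≟_; ≤-refl; ≤-trans; ≤-pred; m≤n⇒m≤1+n; m≤n⇒m<n∨m≡n; m≤n⇒m⊓n≡m; +-comm; n≤1+n)
open import Data.Fin using (Fin; toℕ; fromℕ)
import Data.Fin as Fin
open import Data.Fin.Properties using (any?; toℕ<n; toℕ-injective)
open import Data.List using (List; []; _∷_; length; take)
open import Data.List.Properties using (length-take)
open import Data.List.Membership.Propositional using (_∈_; _∉_)
open import Data.List.Membership.DecPropositional _≟_ using (_∈?_)
open import Data.List.Relation.Unary.Any using (here; there)
import Data.List.Relation.Unary.All as All
open import Data.List.Relation.Unary.AllPairs using (_∷_)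
open import Data.List.Relation.Unary.Unique.Propositional using (Unique)
import Data.List.Relation.Unary.Unique.Propositional.Properties as Unique
import Data.List.Relation.Binary.Sublist.Propositional as Sublist
open import Data.List.Relation.Binary.Sublist.Propositional.Properties using (take-⊆)
open import Data.Product using (∃; _×_; _,_)
open import Data.Sum using (inj₁; inj₂)
open import Data.Empty using (⊥-elim)
open import Relation.Nullary using (¬_; yes; no)
open import Relation.Binary.PropositionalEquality using (_≡_; _≢_; refl; sym; trans; subst)

-- The position colouring of a list T: the head of y ∷ ys gets colour
-- 2 + |ys|, so the entries of a duplicate-free T get the distinct colours
-- 2, …, 1 + |T|, and every point outside T gets colour 1.
positionColouring : List ℕ → ℕ → ℕ
positionColouring []       x = 1
positionColouring (y ∷ ys) x with x ≟ y
... | yes _ = 2 + length ys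
... | no  _ = positionColouring ys x

positionColouring-bounds : ∀ T x → InRange (1 + length T) (positionColouring T x)
positionColouring-bounds []       x = ≤-refl , ≤-refl
positionColouring-bounds (y ∷ ys) x with x ≟ y
... | yes _ = s≤s z≤n , ≤-refl
... | no  _ with positionColouring-bounds ys x
...   | 1≤c , c≤ = 1≤c , m≤n⇒m≤1+n c≤

positionColouring-outside : ∀ T x → x ∉ T → positionColouring T x ≡ 1
positionColouring-outside []       x x∉ = refl
positionColouring-outside (y ∷ ys) x x∉ with x ≟ y
... | yes x≡y = ⊥-elim (x∉ (here x≡y))
... | no  _   = positionColouring-outside ys x (λ x∈ → x∉ (there x∈))

positionColouring-inside : ∀ T x → positionColouring T x ≢ 1 → x ∈ T
positionColouring-inside []       x c≢1 = ⊥-elim (c≢1 refl)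
positionColouring-inside (y ∷ ys) x c≢1 with x ≟ y
... | yes x≡y = here x≡y
... | no  _   = there (positionColouring-inside ys x c≢1)

positionColouring-onto : ∀ T → Unique T → ∀ j → 2 ≤ j → j ≤ 1 + length T →
                         ∃ λ x → x ∈ T × positionColouring T x ≡ j
positionColouring-onto []       _            j (s≤s (s≤s _)) (s≤s ())
positionColouring-onto (y ∷ ys) (y∉ys ∷ uys) j 2≤j j≤ with m≤n⇒m<n∨m≡n j≤
... | inj₂ refl = y , here refl , headColour
  where
  headColour : positionColouring (y ∷ ys) y ≡ 2 + length ys
  headColour with y ≟ y
  ... | yes _  = refl
  ... | no y≢y = ⊥-elim (y≢y refl)
... | inj₁ j<  with positionColouring-onto ys uys j 2≤j (≤-pred j<)
...   | x , x∈ys , cx≡j = x , there x∈ys , tailColour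
  where
  tailColour : positionColouring (y ∷ ys) x ≡ j
  tailColour with x ≟ y
  ... | yes refl = ⊥-elim (All.lookup y∉ys x∈ys refl)
  ... | no  _    = cx≡j

positionColouring-exact : ∀ n T → Unique T → (∀ x → x ∈ T → InRange n x) →
                          (∃ λ x → InRange n x × x ∉ T) →
                          IsExactColoring n (1 + length T) (positionColouring T)
positionColouring-exact n T uniqueT T⊆[n] (x₀ , x₀∈[n] , x₀∉T) =
  (λ x _ → positionColouring-bounds T x) , onto
  where
  onto : ∀ j → InRange (1 + length T) j → ∃ λ x → InRange n x × positionColouring T x ≡ j
  onto (suc zero)    _         = x₀ , x₀∈[n] , positionColouring-outside T x₀ x₀∉T
  onto (suc (suc j)) (_ , j≤) with positionColouring-onto T uniqueT (suc (suc j)) (s≤s (s≤s z≤n)) j≤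
  ... | x , x∈T , cx≡j = x , T⊆[n] x x∈T , cx≡j

injective-avoidsValue : ∀ {m} (f : Fin (suc m) → ℕ) → (∀ i j → i ≢ j → f i ≢ f j) →
                        ∀ v → ∃ λ i → ∀ j → j ≢ i → f j ≢ v
injective-avoidsValue f f-inj v with any? (λ i → f i ≟ v)
... | yes (i , fi≡v) = i , λ j j≢i fj≡v → f-inj j i j≢i (trans fj≡v (sym fi≡v))
... | no  none       = Fin.zero , λ j _ fj≡v → none (j , fj≡v)

-- The first four terms of a rainbow k-AP (k ≥ 4) take any colour v at most
-- once, so three of them lie in every S containing all points not coloured v.
rainbow-puncturedFourAP : ∀ (c : ℕ → ℕ) k a d v (S : List ℕ) → 4 ≤ k → 1 ≤ d →
                          IsRainbow c k a d → (∀ x → c x ≢ v → x ∈ S) →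
                          ContainsPuncturedFourAP S
rainbow-puncturedFourAP c k a d v S 4≤k 1≤d rainbow notV⊆S =
  puncture (injective-avoidsValue term distinct v)
  where
  term : Fin 4 → ℕ
  term j = c (a + toℕ j * d)
  distinct : ∀ i j → i ≢ j → term i ≢ term j
  distinct i j i≢j = rainbow (toℕ i) (toℕ j) (≤-trans (toℕ<n i) 4≤k) (≤-trans (toℕ<n j) 4≤k)
                             (λ eq → i≢j (toℕ-injective eq))
  puncture : (∃ λ i → ∀ j → j ≢ i → term j ≢ v) → ContainsPuncturedFourAP S
  puncture (i , avoid) = a , d , 1≤d , i , λ j j≢i → notV⊆S _ (avoid j j≢i)

-- A set with no punctured 4-AP misses one of 1, 2, 3, since {1, 2, 3} is
-- the 4-AP 1, 2, 3, 4 with its last term removed.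
missesSmallPoint : ∀ (S : List ℕ) → ¬ ContainsPuncturedFourAP S →
                   ∃ λ x → 1 ≤ x × x ≤ 3 × x ∉ S
missesSmallPoint S noPunctured with 1 ∈? S | 2 ∈? S | 3 ∈? S
... | no 1∉S  | _       | _       = 1 , ≤-refl , s≤s z≤n , 1∉S
... | yes _   | no 2∉S  | _       = 2 , s≤s z≤n , s≤s (s≤s z≤n) , 2∉S
... | yes _   | yes _   | no 3∉S  = 3 , s≤s z≤n , ≤-refl , 3∉S
... | yes 1∈S | yes 2∈S | yes 3∈S = ⊥-elim (noPunctured (1 , 1 , ≤-refl , fromℕ 3 , oneTwoThree))
  where
  oneTwoThree : ∀ (j : Fin 4) → j ≢ fromℕ 3 → 1 + toℕ j * 1 ∈ S
  oneTwoThree Fin.zero                               _   = 1∈S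
  oneTwoThree (Fin.suc Fin.zero)                     _   = 2∈S
  oneTwoThree (Fin.suc (Fin.suc Fin.zero))           _   = 3∈S
  oneTwoThree (Fin.suc (Fin.suc (Fin.suc Fin.zero))) j≢3 = ⊥-elim (j≢3 refl)

proposition2p9 : ∀ (n k : ℕ) (S : List ℕ) → 4 ≤ k → k ≤ n
    → IsSubsetOfRange n S → ¬ ContainsPuncturedFourAP S
    → AwGreater n k (length S + 1)
proposition2p9 n k S 4≤k k≤n (uniqueS , S⊆[n]) noPunctured (suc m) _ r≤ forced =
  noPunctured (fromRainbow (forced c exact))
  where
  T : List ℕ
  T = take m S
  c : ℕ → ℕ
  c = positionColouring T
  T⊆S : ∀ {x} → x ∈ T → x ∈ S
  T⊆S = Sublist.lookup (take-⊆ m S)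
  |T|≡m : length T ≡ m
  |T|≡m = trans (length-take m S) (m≤n⇒m⊓n≡m (≤-pred (subst (suc m ≤_) (+-comm (length S) 1) r≤)))
  3≤n : 3 ≤ n
  3≤n = ≤-trans (n≤1+n 3) (≤-trans 4≤k k≤n)
  uncovered : ∃ λ x → InRange n x × x ∉ T
  uncovered with missesSmallPoint S noPunctured
  ... | x , 1≤x , x≤3 , x∉S = x , (1≤x , ≤-trans x≤3 3≤n) , λ x∈T → x∉S (T⊆S x∈T)
  exact : IsExactColoring n (suc m) c
  exact = subst (λ t → IsExactColoring n (suc t) c) |T|≡m
                (positionColouring-exact n T (Unique.take⁺ m uniqueS) (λ x x∈T → S⊆[n] x (T⊆S x∈T)) uncovered)
  fromRainbow : HasRainbowAP n k c → ContainsPuncturedFourAP S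
  fromRainbow (a , d , (1≤d , _ , _) , rainbow) =
    rainbow-puncturedFourAP c k a d 1 S 4≤k 1≤d rainbow (λ x c≢1 → T⊆S (positionColouring-inside T x c≢1))
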